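{- For every $d\in\mathbb{N}$, $$F_d^{(0,1)}(x,1)=\frac{dx}{2}F_d^{(1,0)}(x,1),$$ where $F^{(i,j)}$ denotes the partial derivative of order $i$ in $x$ and order $j$ in $y$.
   Context: The polynomials $F_d(x,y)$ are defined recursively by $F_1(x,y)=1$ and, for $d\ge2$, $$F_d(x,y)=\frac{(1-xy^d)F_{d-1}(x,y)-y(1-x)F_{d-1}(xy,y)}{1-y}$$ (these are polynomials in $x,y$). -}

module Defs where

open import Data.Nat using (ℕ; zero; suc; _∸_; _≡ᵇ_; _⊔_) renaming (_+_ to _+ℕ_)
open import Data.Integer using (ℤ; _+_; _*_; -_; +_; 0ℤ; 1ℤ; -1ℤ)
open import Data.List using (List; []; _∷_; _++_; map; concatMap; foldr; upTo)
open import Data.Product using (_×_; _,_)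
open import Data.Bool using (if_then_else_)

-- A bivariate polynomial in ℤ[x,y] is represented as a formal (unnormalised)
-- finite sum of monomials  c · x^i · y^j.
record Mono2 : Set where
  constructor mono
  field
    cf : ℤ
    ex : ℕ
    ey : ℕ
open Mono2 public

Poly2 : Set
Poly2 = List Mono2

one2 : Poly2
one2 = mono 1ℤ 0 0 ∷ []

_⊕_ : Poly2 → Poly2 → Poly2
p ⊕ q = p ++ q

mulMono : ℤ → ℕ → ℕ → Poly2 → Poly2
mulMono c a b = map (λ m → mono (c * cf m) (a +ℕ ex m) (b +ℕ ey m))

substXY : Poly2 → Poly2
substXY = map (λ m → mono (cf m) (ex m) (ex m +ℕ ey m))

-- an upper bound for the y-degree of the formal sum
degY : Poly2 → ℕ
degY = foldr (λ m acc → ey m ⊔ acc) 0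

-- Exact division by (1 - y):  if P = (1-y) Q then the coefficient of y^k in Q
-- is the sum of the coefficients of y^0..y^k in P, for k < degY P.
-- (This is the expansion P · Σ_k y^k truncated at y-degree degY P - 1, which
-- is the polynomial quotient whenever (1 - y) divides P.)
divOneMinusY : Poly2 → Poly2
divOneMinusY p =
  concatMap (λ m → map (λ k → mono (cf m) (ex m) (ey m +ℕ k)) (upTo (degY p ∸ ey m))) p

-- numerator of the recursion at index d, applied to G = F_{d-1}:
-- (1 - x y^d) G(x,y) - y (1 - x) G(xy,y)
numer : ℕ → Poly2 → Poly2
numer d G = G ⊕ (mulMono -1ℤ 1 d G ⊕ (mulMono -1ℤ 0 1 (substXY G) ⊕ mulMono 1ℤ 1 1 (substXY G)))

-- F d = F_d(x,y) for d ≥ 1   (F 0 is an unused junk value, the zero polynomial)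
F : ℕ → Poly2
F zero = []
F (suc zero) = one2
F (suc (suc n)) = divOneMinusY (numer (suc (suc n)) (F (suc n)))

-- Univariate polynomials in ℤ[x] as formal sums of monomials (c , i) = c · x^i.
Poly1 : Set
Poly1 = List (ℤ × ℕ)

coeff1 : Poly1 → ℕ → ℤ
coeff1 p n = foldr (λ { (c , i) acc → if i ≡ᵇ n then c + acc else acc }) 0ℤ p

dxAtY1 : Poly2 → Poly1
dxAtY1 = map (λ m → (cf m * + ex m , ex m ∸ 1))

dyAtY1 : Poly2 → Poly1
dyAtY1 = map (λ m → (cf m * + ey m , ex m))

mulMono1 : ℤ → ℕ → Poly1 → Poly1
mulMono1 c a = map (λ { (c' , i) → (c * c' , a +ℕ i) })

-- Write F_d = Σ c(k,m) x^k y^m.  Every row of F_d is palindromic, c(k,m) = c(k,dk-m), by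
-- induction on d: if F_{d-1} has rows centred at (d-1)k/2, the numerator N of the recursion
-- has antipalindromic rows, n(k,dk+1-m) = -n(k,m).  Since N = (1-y)F_d, i.e.
-- n(k,m) = c(k,m) - c(k,m-1), the difference c(k,m) - c(k,dk-m) does not depend on m, and it
-- vanishes for m outside the support.  A palindromic row satisfies
-- 2 Σ_m m c(k,m) = dk Σ_m c(k,m), which is the coefficient of x^k in the claimed identity.
module Submission where

open import Defs
open import Data.Nat as ℕ using (ℕ; zero; suc; _≤_; _∸_; _≡ᵇ_; s≤s)
import Data.Nat.Properties as ℕP
open import Data.Integer as ℤ using (ℤ; +_; -[1+_]; 0ℤ; 1ℤ; -1ℤ; _+_; _*_; -_; _-_)
import Data.Integer.Properties as ℤP
open import Data.Integer.Tactic.RingSolver using (solve-∀)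
open import Data.Fin using (Fin; toℕ; fromℕ<; opposite; punchIn)
import Data.Fin.Properties as FinP
import Data.Fin.Permutation as Perm
open import Data.List using ([]; _∷_; [_]; _++_; map; upTo; concatMap)
open import Data.List.Properties using (map-++; upTo-∷ʳ)
open import Data.List.Relation.Unary.All as All using (All; []; _∷_)
open import Data.Product using (Σ-syntax; _,_)
open import Data.Sum using (_⊎_; inj₁; inj₂)
open import Data.Bool using (if_then_else_)
open import Function using (id; _∘_)
open import Relation.Nullary using (does; yes; no; contradiction)
open import Relation.Binary.PropositionalEquality
  using (_≡_; _≢_; refl; sym; trans; cong; cong₂; subst)
open import Algebra.Properties.AbelianGroup ℤP.+-0-abelianGroup using (∙-cancelˡ)
open import Algebra.Properties.Semiring.Sum ℤP.+-*-semiring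
  using (sum; sum-cong-≗; sum-replicate-zero; sum-remove; sum-permute; ∑-distrib-+; *-distribˡ-sum)
open Relation.Binary.PropositionalEquality.≡-Reasoning

opaque
  δ : ℤ → ℤ → ℤ
  δ a b = if does (a ℤ.≟ b) then 1ℤ else 0ℤ

  δ-refl : ∀ a → δ a a ≡ 1ℤ
  δ-refl a with a ℤ.≟ a
  ... | yes _   = refl
  ... | no a≢a  = contradiction refl a≢a

  δ-≢ : ∀ {a b} → a ≢ b → δ a b ≡ 0ℤ
  δ-≢ {a} {b} a≢b with a ℤ.≟ b
  ... | yes a≡b = contradiction a≡b a≢b
  ... | no _    = refl

  δ-cong-⇔ : ∀ {a b c e} → (a ≡ b → c ≡ e) → (c ≡ e → a ≡ b) → δ a b ≡ δ c e
  δ-cong-⇔ {a} {b} {c} {e} to from with a ℤ.≟ b | c ℤ.≟ e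
  ... | yes _   | yes _   = refl
  ... | no _    | no _    = refl
  ... | yes a≡b | no c≢e  = contradiction (to a≡b) c≢e
  ... | no a≢b  | yes c≡e = contradiction (from c≡e) a≢b

  δ-*-cong : ∀ {a b} x y → (a ≡ b → x ≡ y) → δ a b * x ≡ δ a b * y
  δ-*-cong {a} {b} x y a≡b⇒x≡y with a ℤ.≟ b
  ... | yes a≡b = cong (1ℤ *_) (a≡b⇒x≡y a≡b)
  ... | no _    = refl

δ-shift : ∀ x y k → δ (x + y) k ≡ δ y (k - x)
δ-shift x y k = δ-cong-⇔ (λ p → trans (y≡x+y-x x y) (cong (_- x) p))
                         (λ p → trans (cong (λ z → x + z) p) (x+[k-x]≡k x k))
  where
  y≡x+y-x : ∀ x y → y ≡ x + y - x
  y≡x+y-x = solve-∀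
  x+[k-x]≡k : ∀ x k → x + (k - x) ≡ k
  x+[k-x]≡k = solve-∀

-- rowMoment P k w = Σ_m w(m)·coeff P k m, so rowSum P k is the coefficient of x^k in P(x,1).
-- Indices range over ℤ so that shifted indices need no truncated subtraction; coefficients at
-- negative indices are 0.
coeff : Poly2 → ℤ → ℤ → ℤ
coeff []      k m = 0ℤ
coeff (μ ∷ P) k m = δ (+ ex μ) k * (δ (+ ey μ) m * cf μ) + coeff P k m

rowMoment : Poly2 → ℤ → (ℤ → ℤ) → ℤ
rowMoment []      k w = 0ℤ
rowMoment (μ ∷ P) k w = δ (+ ex μ) k * (cf μ * w (+ ey μ)) + rowMoment P k w

rowSum : Poly2 → ℤ → ℤ
rowSum P k = rowMoment P k (λ _ → 1ℤ)

coeff-++ : ∀ P Q k m → coeff (P ++ Q) k m ≡ coeff P k m + coeff Q k m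
coeff-++ []      Q k m = sym (ℤP.+-identityˡ _)
coeff-++ (μ ∷ P) Q k m =
  trans (cong (λ z → t + z) (coeff-++ P Q k m)) (sym (ℤP.+-assoc t (coeff P k m) (coeff Q k m)))
  where t = δ (+ ex μ) k * (δ (+ ey μ) m * cf μ)

rowSum-++ : ∀ P Q k → rowSum (P ++ Q) k ≡ rowSum P k + rowSum Q k
rowSum-++ []      Q k = sym (ℤP.+-identityˡ _)
rowSum-++ (μ ∷ P) Q k =
  trans (cong (λ z → t + z) (rowSum-++ P Q k)) (sym (ℤP.+-assoc t (rowSum P k) (rowSum Q k)))
  where t = δ (+ ex μ) k * (cf μ * 1ℤ)

coeff-mulMono : ∀ c a b P k m → coeff (mulMono c a b P) k m ≡ c * coeff P (k - + a) (m - + b)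
coeff-mulMono c a b []      k m = sym (ℤP.*-zeroʳ c)
coeff-mulMono c a b (μ ∷ P) k m =
  trans (cong₂ _+_ (cong₂ (λ u v → u * (v * (c * cf μ))) (δ-shift (+ a) (+ ex μ) k) (δ-shift (+ b) (+ ey μ) m))
                   (coeff-mulMono c a b P k m))
        (factor (δ (+ ex μ) (k - + a)) (δ (+ ey μ) (m - + b)) (cf μ) (coeff P (k - + a) (m - + b)) c)
  where
  factor : ∀ u v f r c → u * (v * (c * f)) + c * r ≡ c * (u * (v * f) + r)
  factor = solve-∀

rowSum-mulMono : ∀ c a b P k → rowSum (mulMono c a b P) k ≡ c * rowSum P (k - + a)
rowSum-mulMono c a b []      k = sym (ℤP.*-zeroʳ c)
rowSum-mulMono c a b (μ ∷ P) k =
  trans (cong₂ _+_ (cong (λ u → u * (c * cf μ * 1ℤ)) (δ-shift (+ a) (+ ex μ) k)) (rowSum-mulMono c a b P k))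
        (factor (δ (+ ex μ) (k - + a)) (cf μ) (rowSum P (k - + a)) c)
  where
  factor : ∀ u f r c → u * (c * f * 1ℤ) + c * r ≡ c * (u * (f * 1ℤ) + r)
  factor = solve-∀

coeff-substXY : ∀ P k m → coeff (substXY P) k m ≡ coeff P k (m - k)
coeff-substXY []      k m = refl
coeff-substXY (μ ∷ P) k m = cong₂ _+_ (δ-*-cong _ _ shift) (coeff-substXY P k m)
  where
  shift : + ex μ ≡ k → δ (+ ex μ + + ey μ) m * cf μ ≡ δ (+ ey μ) (m - k) * cf μ
  shift ex≡k = cong (_* cf μ) (trans (δ-shift (+ ex μ) (+ ey μ) m) (cong (λ i → δ (+ ey μ) (m - i)) ex≡k))

rowSum-substXY : ∀ P k → rowSum (substXY P) k ≡ rowSum P k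
rowSum-substXY []      k = refl
rowSum-substXY (μ ∷ P) k = cong (λ z → δ (+ ex μ) k * (cf μ * 1ℤ) + z) (rowSum-substXY P k)

coeff-numer : ∀ d G k m → coeff (numer d G) k m ≡
  coeff G k m - coeff G (k - 1ℤ) (m - + d) - coeff G k (m - 1ℤ - k) + coeff G (k - 1ℤ) (m - k)
coeff-numer d G k m = begin
  coeff (G ⊕ (xyᵈG ⊕ (yG[xy] ⊕ xyG[xy]))) k m
    ≡⟨ coeff-++ G _ k m ⟩
  g k m + coeff (xyᵈG ⊕ (yG[xy] ⊕ xyG[xy])) k m
    ≡⟨ cong (λ z → g k m + z) (trans (coeff-++ xyᵈG _ k m)
                       (cong₂ _+_ (coeff-mulMono -1ℤ 1 d G k m)
                                  (trans (coeff-++ yG[xy] xyG[xy] k m) (cong₂ _+_ yG-coeff xyG-coeff)))) ⟩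
  g k m + (-1ℤ * g (k - 1ℤ) (m - + d) + (-1ℤ * g k (m - 1ℤ - k) + 1ℤ * g (k - 1ℤ) (m - k)))
    ≡⟨ collect (g k m) (g (k - 1ℤ) (m - + d)) (g k (m - 1ℤ - k)) (g (k - 1ℤ) (m - k)) ⟩
  g k m - g (k - 1ℤ) (m - + d) - g k (m - 1ℤ - k) + g (k - 1ℤ) (m - k) ∎
  where
  g = coeff G
  xyᵈG = mulMono -1ℤ 1 d G
  yG[xy] = mulMono -1ℤ 0 1 (substXY G)
  xyG[xy] = mulMono 1ℤ 1 1 (substXY G)
  yG-coeff : coeff yG[xy] k m ≡ -1ℤ * g k (m - 1ℤ - k)
  yG-coeff = trans (coeff-mulMono -1ℤ 0 1 (substXY G) k m)
                   (trans (cong (-1ℤ *_) (coeff-substXY G (k - + 0) (m - 1ℤ)))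
                          (cong (λ i → -1ℤ * g i (m - 1ℤ - i)) (ℤP.+-identityʳ k)))
  m-1-[k-1]≡m-k : ∀ m k → m - 1ℤ - (k - 1ℤ) ≡ m - k
  m-1-[k-1]≡m-k = solve-∀
  xyG-coeff : coeff xyG[xy] k m ≡ 1ℤ * g (k - 1ℤ) (m - k)
  xyG-coeff = trans (coeff-mulMono 1ℤ 1 1 (substXY G) k m)
                    (trans (cong (1ℤ *_) (coeff-substXY G (k - 1ℤ) (m - 1ℤ)))
                           (cong (λ j → 1ℤ * g (k - 1ℤ) j) (m-1-[k-1]≡m-k m k)))
  collect : ∀ a b c e → a + (-1ℤ * b + (-1ℤ * c + 1ℤ * e)) ≡ a - b - c + e
  collect = solve-∀

rowSum-numer : ∀ d G k → rowSum (numer d G) k ≡ 0ℤ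
rowSum-numer d G k = begin
  rowSum (G ⊕ (xyᵈG ⊕ (yG[xy] ⊕ xyG[xy]))) k
    ≡⟨ rowSum-++ G _ k ⟩
  r k + rowSum (xyᵈG ⊕ (yG[xy] ⊕ xyG[xy])) k
    ≡⟨ cong (λ z → r k + z) (trans (rowSum-++ xyᵈG _ k)
                     (cong₂ _+_ (rowSum-mulMono -1ℤ 1 d G k)
                                (trans (rowSum-++ yG[xy] xyG[xy] k)
                                       (cong₂ _+_ (substituted -1ℤ 0) (substituted 1ℤ 1))))) ⟩
  r k + (-1ℤ * r (k - 1ℤ) + (-1ℤ * r (k - + 0) + 1ℤ * r (k - 1ℤ)))
    ≡⟨ cong (λ i → r k + (-1ℤ * r (k - 1ℤ) + (-1ℤ * r i + 1ℤ * r (k - 1ℤ)))) (ℤP.+-identityʳ k) ⟩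
  r k + (-1ℤ * r (k - 1ℤ) + (-1ℤ * r k + 1ℤ * r (k - 1ℤ)))
    ≡⟨ cancel (r k) (r (k - 1ℤ)) ⟩
  0ℤ ∎
  where
  r = rowSum G
  xyᵈG = mulMono -1ℤ 1 d G
  yG[xy] = mulMono -1ℤ 0 1 (substXY G)
  xyG[xy] = mulMono 1ℤ 1 1 (substXY G)
  substituted : ∀ c a → rowSum (mulMono c a 1 (substXY G)) k ≡ c * r (k - + a)
  substituted c a = trans (rowSum-mulMono c a 1 (substXY G) k) (cong (c *_) (rowSum-substXY G (k - + a)))
  cancel : ∀ a b → a + (-1ℤ * b + (-1ℤ * a + 1ℤ * b)) ≡ 0ℤ
  cancel = solve-∀

degY-bound : ∀ P → All (λ μ → ey μ ≤ degY P) P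
degY-bound []      = []
degY-bound (μ ∷ P) = ℕP.m≤m⊔n (ey μ) (degY P)
                   ∷ All.map (λ le → ℕP.≤-trans le (ℕP.m≤n⊔m (ey μ) (degY P))) (degY-bound P)

coeff-≡0 : ∀ P k m → All (λ μ → + ex μ ≢ k ⊎ + ey μ ≢ m) P → coeff P k m ≡ 0ℤ
coeff-≡0 []      k m []                 = refl
coeff-≡0 (μ ∷ P) k m (inj₁ ex≢k ∷ rest) =
  cong₂ _+_ (cong (_* _) (δ-≢ ex≢k)) (coeff-≡0 P k m rest)
coeff-≡0 (μ ∷ P) k m (inj₂ ey≢m ∷ rest) =
  cong₂ _+_ (trans (cong (λ v → δ (+ ex μ) k * (v * cf μ)) (δ-≢ ey≢m)) (ℤP.*-zeroʳ (δ (+ ex μ) k)))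
            (coeff-≡0 P k m rest)

coeff-neg-row : ∀ P s m → coeff P -[1+ s ] m ≡ 0ℤ
coeff-neg-row P s m = coeff-≡0 P _ m (All.universal (λ _ → inj₁ λ ()) P)

coeff-neg-column : ∀ P k s → coeff P k -[1+ s ] ≡ 0ℤ
coeff-neg-column P k s = coeff-≡0 P k _ (All.universal (λ _ → inj₂ λ ()) P)

coeff-above : ∀ D P k → All (λ μ → ey μ ≤ D) P → ∀ j → coeff P k (+ (suc D ℕ.+ j)) ≡ 0ℤ
coeff-above D P k bound j =
  coeff-≡0 P k _ (All.map (λ le → inj₂ (λ eq → too-large le (ℤP.+-injective eq))) bound)
  where
  too-large : ∀ {e} → e ≤ D → e ≢ suc D ℕ.+ j
  too-large le refl = ℕP.1+n≰n (ℕP.m+n≤o⇒m≤o (suc D) le)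

Δ : (ℤ → ℤ) → ℤ → ℤ
Δ q m = q m - q (m - 1ℤ)

Δ-coeff-++ : ∀ P Q k m → Δ (coeff (P ++ Q) k) m ≡ Δ (coeff P k) m + Δ (coeff Q k) m
Δ-coeff-++ P Q k m =
  trans (cong₂ _-_ (coeff-++ P Q k m) (coeff-++ P Q k (m - 1ℤ)))
        (regroup (coeff P k m) (coeff Q k m) (coeff P k (m - 1ℤ)) (coeff Q k (m - 1ℤ)))
  where
  regroup : ∀ a b c e → a + b - (c + e) ≡ a - c + (b - e)
  regroup = solve-∀

Δ-coeff-monomial : ∀ c a e k m →
  Δ (coeff [ mono c a e ] k) m ≡ δ (+ a) k * ((δ (+ e) m - δ (+ suc e) m) * c)
Δ-coeff-monomial c a e k m =
  trans (cong (λ v → δ (+ a) k * (δ (+ e) m * c) + 0ℤ - (δ (+ a) k * (v * c) + 0ℤ))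
              (sym (δ-shift 1ℤ (+ e) m)))
        (factor (δ (+ a) k) (δ (+ e) m) (δ (+ suc e) m) c)
  where
  factor : ∀ x u v c → x * (u * c) + 0ℤ - (x * (v * c) + 0ℤ) ≡ x * ((u - v) * c)
  factor = solve-∀

-- c·x^a·(y^e + ⋯ + y^(e+L-1)), so that (1-y)·yBlock c a e L = c·x^a·(y^e - y^(e+L)).
yBlock : ℤ → ℕ → ℕ → ℕ → Poly2
yBlock c a e L = map (λ j → mono c a (e ℕ.+ j)) (upTo L)

Δ-coeff-yBlock : ∀ c a e L k m →
  Δ (coeff (yBlock c a e L) k) m ≡ δ (+ a) k * ((δ (+ e) m - δ (+ (e ℕ.+ L)) m) * c)
Δ-coeff-yBlock c a e zero k m =
  trans (vanish (δ (+ a) k) (δ (+ e) m) c)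
        (cong (λ j → δ (+ a) k * ((δ (+ e) m - δ (+ j) m) * c)) (sym (ℕP.+-identityʳ e)))
  where
  vanish : ∀ x u c → 0ℤ - 0ℤ ≡ x * ((u - u) * c)
  vanish = solve-∀
Δ-coeff-yBlock c a e (suc L) k m = begin
  Δ (coeff (yBlock c a e (suc L)) k) m
    ≡⟨ cong (λ P → Δ (coeff P k) m) (trans (cong (map f) (sym (upTo-∷ʳ L))) (map-++ f (upTo L) [ L ])) ⟩
  Δ (coeff (yBlock c a e L ++ [ mono c a (e ℕ.+ L) ]) k) m
    ≡⟨ Δ-coeff-++ (yBlock c a e L) _ k m ⟩
  Δ (coeff (yBlock c a e L) k) m + Δ (coeff [ mono c a (e ℕ.+ L) ] k) m
    ≡⟨ cong₂ _+_ (Δ-coeff-yBlock c a e L k m) (Δ-coeff-monomial c a (e ℕ.+ L) k m) ⟩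
  x * ((δ (+ e) m - δ (+ (e ℕ.+ L)) m) * c) + x * ((δ (+ (e ℕ.+ L)) m - δ (+ suc (e ℕ.+ L)) m) * c)
    ≡⟨ telescope x (δ (+ e) m) (δ (+ (e ℕ.+ L)) m) (δ (+ suc (e ℕ.+ L)) m) c ⟩
  x * ((δ (+ e) m - δ (+ suc (e ℕ.+ L)) m) * c)
    ≡⟨ cong (λ j → x * ((δ (+ e) m - δ (+ j) m) * c)) (sym (ℕP.+-suc e L)) ⟩
  x * ((δ (+ e) m - δ (+ (e ℕ.+ suc L)) m) * c) ∎
  where
  f = λ j → mono c a (e ℕ.+ j)
  x = δ (+ a) k
  telescope : ∀ x u v w c → x * ((u - v) * c) + x * ((v - w) * c) ≡ x * ((u - w) * c)
  telescope = solve-∀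

-- divOneMinusY P unfolds to yBlocks (degY P) P.
yBlocks : ℕ → Poly2 → Poly2
yBlocks D = concatMap (λ μ → yBlock (cf μ) (ex μ) (ey μ) (D ∸ ey μ))

Δ-coeff-yBlocks : ∀ D P k m → All (λ μ → ey μ ≤ D) P →
  Δ (coeff (yBlocks D P) k) m ≡ coeff P k m - δ (+ D) m * rowSum P k
Δ-coeff-yBlocks D []      k m []           = cong (λ z → 0ℤ - z) (sym (ℤP.*-zeroʳ (δ (+ D) m)))
Δ-coeff-yBlocks D (μ ∷ P) k m (e≤D ∷ bound) = begin
  Δ (coeff (yBlock c a e (D ∸ e) ++ yBlocks D P) k) m
    ≡⟨ Δ-coeff-++ (yBlock c a e (D ∸ e)) _ k m ⟩
  Δ (coeff (yBlock c a e (D ∸ e)) k) m + Δ (coeff (yBlocks D P) k) m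
    ≡⟨ cong₂ _+_ (Δ-coeff-yBlock c a e (D ∸ e) k m) (Δ-coeff-yBlocks D P k m bound) ⟩
  x * ((δ (+ e) m - δ (+ (e ℕ.+ (D ∸ e))) m) * c) + (coeff P k m - δ (+ D) m * rowSum P k)
    ≡⟨ cong (λ j → x * ((δ (+ e) m - δ (+ j) m) * c) + (coeff P k m - δ (+ D) m * rowSum P k))
            (ℕP.m+[n∸m]≡n e≤D) ⟩
  x * ((δ (+ e) m - δ (+ D) m) * c) + (coeff P k m - δ (+ D) m * rowSum P k)
    ≡⟨ regroup x (δ (+ e) m) (δ (+ D) m) c (coeff P k m) (rowSum P k) ⟩
  x * (δ (+ e) m * c) + coeff P k m - δ (+ D) m * (x * (c * 1ℤ) + rowSum P k) ∎
  where
  c = cf μ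
  a = ex μ
  e = ey μ
  x = δ (+ a) k
  regroup : ∀ x u v c q r → x * ((u - v) * c) + (q - v * r) ≡ x * (u * c) + q - v * (x * (c * 1ℤ) + r)
  regroup = solve-∀

Δ-coeff-divOneMinusY : ∀ P → (∀ k → rowSum P k ≡ 0ℤ) →
  ∀ k m → Δ (coeff (divOneMinusY P) k) m ≡ coeff P k m
Δ-coeff-divOneMinusY P P[x,1]≡0 k m = begin
  Δ (coeff (yBlocks (degY P) P) k) m
    ≡⟨ Δ-coeff-yBlocks (degY P) P k m (degY-bound P) ⟩
  coeff P k m - δ (+ degY P) m * rowSum P k
    ≡⟨ cong (λ r → coeff P k m - δ (+ degY P) m * r) (P[x,1]≡0 k) ⟩
  coeff P k m - δ (+ degY P) m * 0ℤ
    ≡⟨ cong (λ r → coeff P k m - r) (ℤP.*-zeroʳ (δ (+ degY P) m)) ⟩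
  coeff P k m + 0ℤ
    ≡⟨ ℤP.+-identityʳ _ ⟩
  coeff P k m ∎

Palindromic : ℤ → (ℤ → ℤ) → Set
Palindromic K q = ∀ m → q (K - m) ≡ q m

Antipalindromic : ℤ → (ℤ → ℤ) → Set
Antipalindromic K q = ∀ m → q (K - m) ≡ - q m

constant-of-step-invariant : ∀ {A : Set} (f : ℤ → A) → (∀ m → f (1ℤ + m) ≡ f m) →
  ∀ m → f m ≡ f 0ℤ
constant-of-step-invariant f step (+ zero)       = refl
constant-of-step-invariant f step (+ suc n)      = trans (step (+ n)) (constant-of-step-invariant f step (+ n))
constant-of-step-invariant f step -[1+ zero ]    = sym (step -[1+ zero ])
constant-of-step-invariant f step -[1+ suc n ]   =
  trans (sym (step -[1+ suc n ])) (constant-of-step-invariant f step -[1+ n ])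

palindromic-of-Δ-antipalindromic : ∀ K D q →
  (∀ s → q -[1+ s ] ≡ 0ℤ) → (∀ j → q (+ (suc D ℕ.+ j)) ≡ 0ℤ) →
  Antipalindromic (+ suc K) (Δ q) → Palindromic (+ K) q
palindromic-of-Δ-antipalindromic K D q q<0 q>D anti m = ℤP.i-j≡0⇒i≡j _ _ (begin
  h m             ≡⟨ constant-of-step-invariant h step m ⟩
  h 0ℤ            ≡⟨ constant-of-step-invariant h step -[1+ D ] ⟨
  h -[1+ D ]      ≡⟨ cong₂ _-_ (trans (cong (λ j → q (+ j)) (ℕP.+-comm K (suc D))) (q>D K)) (q<0 D) ⟩
  0ℤ              ∎)
  where
  h : ℤ → ℤ
  h m = q (+ K - m) - q m
  step : ∀ m → h (1ℤ + m) ≡ h m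
  step m = begin
    A - C                            ≡⟨ regroup A B C E ⟩
    B - E - ((B - A) + (C - E))      ≡⟨ cong (λ z → B - E - (z + (C - E))) reflected ⟩
    B - E - (- (C - E) + (C - E))    ≡⟨ cong (λ z → B - E - z) (ℤP.+-inverseˡ (C - E)) ⟩
    B - E - 0ℤ                       ≡⟨ ℤP.+-identityʳ _ ⟩
    B - E                            ∎
    where
    A = q (+ K - (1ℤ + m))
    B = q (+ K - m)
    C = q (1ℤ + m)
    E = q m
    regroup : ∀ a b c e → a - c ≡ b - e - ((b - a) + (c - e))
    regroup = solve-∀
    i₁ : ∀ K m → K - m ≡ 1ℤ + K - (1ℤ + m)
    i₁ = solve-∀
    i₂ : ∀ K m → K - (1ℤ + m) ≡ 1ℤ + K - (1ℤ + m) - 1ℤ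
    i₂ = solve-∀
    i₃ : ∀ m → 1ℤ + m - 1ℤ ≡ m
    i₃ = solve-∀
    reflected : B - A ≡ - (C - E)
    reflected = begin
      B - A                       ≡⟨ cong₂ (λ i j → q i - q j) (i₁ (+ K) m) (i₂ (+ K) m) ⟩
      Δ q (+ suc K - (1ℤ + m))    ≡⟨ anti (1ℤ + m) ⟩
      - Δ q (1ℤ + m)              ≡⟨ cong (λ i → - (C - q i)) (i₃ m) ⟩
      - (C - E)                   ∎

PalindromicRows : ℕ → Poly2 → Set
PalindromicRows d P = ∀ k → Palindromic (+ d * k) (coeff P k)

PalindromicRows-constant : ∀ d c → PalindromicRows d (mono c 0 0 ∷ [])
PalindromicRows-constant d c k m =
  cong (_+ 0ℤ) (δ-*-cong _ _ (λ 0≡k → cong (_* c) (δ-cong-⇔ (to 0≡k) (from 0≡k))))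
  where
  centre : 0ℤ ≡ k → + d * k - m ≡ - m
  centre refl = trans (cong (_- m) (ℤP.*-zeroʳ (+ d))) (ℤP.+-identityˡ (- m))
  to : 0ℤ ≡ k → 0ℤ ≡ + d * k - m → 0ℤ ≡ m
  to 0≡k eq = ℤP.neg-injective (trans eq (centre 0≡k))
  from : 0ℤ ≡ k → 0ℤ ≡ m → 0ℤ ≡ + d * k - m
  from 0≡k eq = trans (cong -_ eq) (sym (centre 0≡k))

numer-antipalindromic : ∀ e G → PalindromicRows e G →
  ∀ k → Antipalindromic (1ℤ + + suc e * k) (coeff (numer (suc e) G) k)
numer-antipalindromic e G pal k m = begin
  coeff (numer (suc e) G) k m'
    ≡⟨ coeff-numer (suc e) G k m' ⟩
  g k m' - g (k - 1ℤ) (m' - d) - g k (m' - 1ℤ - k) + g (k - 1ℤ) (m' - k)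
    ≡⟨ cong₂ _+_ (cong₂ _-_ (cong₂ _-_ (reflect k (i₁ E k m)) (reflect (k - 1ℤ) (i₂ E k m)))
                            (reflect k (i₃ E k m)))
                 (reflect (k - 1ℤ) (i₄ E k m)) ⟩
  g k (m - 1ℤ - k) - g (k - 1ℤ) (m - k) - g k m + g (k - 1ℤ) (m - d)
    ≡⟨ flip (g k m) (g (k - 1ℤ) (m - d)) (g k (m - 1ℤ - k)) (g (k - 1ℤ) (m - k)) ⟩
  - (g k m - g (k - 1ℤ) (m - d) - g k (m - 1ℤ - k) + g (k - 1ℤ) (m - k))
    ≡⟨ cong -_ (coeff-numer (suc e) G k m) ⟨
  - coeff (numer (suc e) G) k m ∎
  where
  g = coeff G
  E = + e
  d = + suc e
  m' = 1ℤ + d * k - m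
  reflect : ∀ i {j j′} → E * i - j ≡ j′ → g i j ≡ g i j′
  reflect i {j} eq = trans (sym (pal i j)) (cong (g i) eq)
  i₁ : ∀ E k m → E * k - (1ℤ + (1ℤ + E) * k - m) ≡ m - 1ℤ - k
  i₁ = solve-∀
  i₂ : ∀ E k m → E * (k - 1ℤ) - (1ℤ + (1ℤ + E) * k - m - (1ℤ + E)) ≡ m - k
  i₂ = solve-∀
  i₃ : ∀ E k m → E * k - (1ℤ + (1ℤ + E) * k - m - 1ℤ - k) ≡ m
  i₃ = solve-∀
  i₄ : ∀ E k m → E * (k - 1ℤ) - (1ℤ + (1ℤ + E) * k - m - k) ≡ m - (1ℤ + E)
  i₄ = solve-∀
  flip : ∀ a b c e → c - e - a + b ≡ - (a - b - c + e)
  flip = solve-∀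

PalindromicRows-divOneMinusY : ∀ e G → PalindromicRows e G →
  PalindromicRows (suc e) (divOneMinusY (numer (suc e) G))
PalindromicRows-divOneMinusY e G pal -[1+ s ] m =
  trans (coeff-neg-row Q s _) (sym (coeff-neg-row Q s m))
  where Q = divOneMinusY (numer (suc e) G)
PalindromicRows-divOneMinusY e G pal (+ k) =
  subst (λ K → Palindromic K (coeff Q (+ k))) (ℤP.pos-* (suc e) k)
        (palindromic-of-Δ-antipalindromic (suc e ℕ.* k) (degY Q) (coeff Q (+ k))
          (coeff-neg-column Q (+ k)) (coeff-above (degY Q) Q (+ k) (degY-bound Q)) antiΔ)
  where
  N = numer (suc e) G
  Q = divOneMinusY N
  ΔQ≡N : ∀ m → Δ (coeff Q (+ k)) m ≡ coeff N (+ k) m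
  ΔQ≡N = Δ-coeff-divOneMinusY N (rowSum-numer (suc e) G) (+ k)
  antiΔ : Antipalindromic (+ suc (suc e ℕ.* k)) (Δ (coeff Q (+ k)))
  antiΔ m = begin
    Δ (coeff Q (+ k)) (+ suc (suc e ℕ.* k) - m)
      ≡⟨ ΔQ≡N _ ⟩
    coeff N (+ k) (1ℤ + + (suc e ℕ.* k) - m)
      ≡⟨ cong (λ K → coeff N (+ k) (1ℤ + K - m)) (ℤP.pos-* (suc e) k) ⟩
    coeff N (+ k) (1ℤ + + suc e * + k - m)
      ≡⟨ numer-antipalindromic e G pal (+ k) m ⟩
    - coeff N (+ k) m
      ≡⟨ cong -_ (ΔQ≡N m) ⟨
    - Δ (coeff Q (+ k)) m ∎

PalindromicRows-F : ∀ n → PalindromicRows (suc n) (F (suc n))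
PalindromicRows-F zero    = PalindromicRows-constant 1 1ℤ
PalindromicRows-F (suc n) = PalindromicRows-divOneMinusY (suc n) (F (suc n)) (PalindromicRows-F n)

sumFrom : ℤ → ℕ → (ℤ → ℤ) → ℤ
sumFrom a n f = sum (λ (i : Fin n) → f (a + + toℕ i))

sum-≗0 : ∀ {n} (f : Fin n → ℤ) → (∀ i → f i ≡ 0ℤ) → sum f ≡ 0ℤ
sum-≗0 {n} f f≗0 = trans (sum-cong-≗ f≗0) (sum-replicate-zero n)

sumFrom-δ : ∀ a {n} (i : Fin n) (f : ℤ → ℤ) {e} → a + + toℕ i ≡ e →
  sumFrom a n (λ m → δ e m * f m) ≡ f e
sumFrom-δ a {suc n} i f refl = begin
  sum t                             ≡⟨ sum-remove {i = i} t ⟩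
  t i + sum (λ j → t (punchIn i j)) ≡⟨ cong₂ _+_ (trans (cong (_* f x) (δ-refl x)) (ℤP.*-identityˡ (f x)))
                                                   (sum-≗0 (λ j → t (punchIn i j)) elsewhere) ⟩
  f x + 0ℤ                          ≡⟨ ℤP.+-identityʳ (f x) ⟩
  f x                               ∎
  where
  x : ℤ
  x = a + + toℕ i
  t : Fin (suc n) → ℤ
  t j = δ x (a + + toℕ j) * f (a + + toℕ j)
  elsewhere : ∀ j → t (punchIn i j) ≡ 0ℤ
  elsewhere j = cong (_* f (a + + toℕ (punchIn i j))) (δ-≢ λ eq → FinP.punchInᵢ≢i i j
    (sym (FinP.toℕ-injective (ℤP.+-injective (∙-cancelˡ a (+ toℕ i) (+ toℕ (punchIn i j)) eq)))))

sumFrom-reflect : ∀ a n f → sumFrom a (suc n) f ≡ sumFrom a (suc n) (λ m → f (a + a + + n - m))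
sumFrom-reflect a n f =
  trans (sum-permute (λ i → f (a + + toℕ i)) Perm.reverse) (sum-cong-≗ (λ i → cong f (reflected i)))
  where
  reflected : ∀ i → a + + toℕ (opposite i) ≡ a + a + + n - (a + + toℕ i)
  reflected i = begin
    a + + toℕ (opposite i)   ≡⟨ cong (λ j → a + + j) (FinP.opposite-prop i) ⟩
    a + + (n ∸ toℕ i)        ≡⟨ cong (λ z → a + z) (pos-∸ (FinP.toℕ≤pred[n] i)) ⟩
    a + (+ n - + toℕ i)      ≡⟨ rearrange a (+ n) (+ toℕ i) ⟩
    a + a + + n - (a + + toℕ i) ∎
    where
    pos-∸ : ∀ {m n} → n ≤ m → + (m ∸ n) ≡ + m - + n
    pos-∸ {m} {n} n≤m = sym (trans (ℤP.m-n≡m⊖n m n) (ℤP.⊖-≥ n≤m))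
    rearrange : ∀ a n j → a + (n - j) ≡ a + a + n - (a + j)
    rearrange = solve-∀

moment-palindromic : ∀ a n q → Palindromic (a + a + + n) q →
  + 2 * sumFrom a (suc n) (λ m → m * q m) ≡ (a + a + + n) * sumFrom a (suc n) q
moment-palindromic a n q pal = begin
  + 2 * M
    ≡⟨ double M ⟩
  M + M
    ≡⟨ cong (λ z → M + z) (sumFrom-reflect a n (λ m → m * q m)) ⟩
  M + S (λ m → (c - m) * q (c - m))
    ≡⟨ cong (λ z → M + z) (sum-cong-≗ {suc n} (λ i → cong ((c - (at i)) *_) (pal (at i)))) ⟩
  M + S (λ m → (c - m) * q m)
    ≡⟨ ∑-distrib-+ {suc n} (λ i → (at i) * q (at i)) (λ i → (c - (at i)) * q (at i)) ⟨
  S (λ m → m * q m + (c - m) * q m)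
    ≡⟨ sum-cong-≗ {suc n} (λ i → collect (at i) c (q (at i))) ⟩
  S (λ m → c * q m)
    ≡⟨ *-distribˡ-sum {suc n} c (λ i → q (at i)) ⟨
  c * S q ∎
  where
  c = a + a + + n
  at = λ (i : Fin (suc n)) → a + + toℕ i
  S = sumFrom a (suc n)
  M = S (λ m → m * q m)
  double : ∀ x → + 2 * x ≡ x + x
  double = solve-∀
  collect : ∀ m c x → m * x + (c - m) * x ≡ c * x
  collect = solve-∀

rowMoment-sumFrom : ∀ a n P k w → All (λ μ → Σ[ i ∈ Fin n ] a + + toℕ i ≡ + ey μ) P →
  rowMoment P k w ≡ sumFrom a n (λ m → w m * coeff P k m)
rowMoment-sumFrom a n []      k w []               =
  sym (sum-≗0 {n} (λ i → w (a + + toℕ i) * 0ℤ) (λ i → ℤP.*-zeroʳ (w (a + + toℕ i))))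
rowMoment-sumFrom a n (μ ∷ P) k w ((i , eq) ∷ rest) = sym (begin
  sumFrom a n (λ m → w m * (x * (δ (+ ey μ) m * c) + coeff P k m))
    ≡⟨ sum-cong-≗ {n} (λ j → expand (w (at j)) x (δ (+ ey μ) (at j)) c (coeff P k (at j))) ⟩
  sumFrom a n (λ m → δ (+ ey μ) m * (x * (c * w m)) + w m * coeff P k m)
    ≡⟨ ∑-distrib-+ {n} (λ j → δ (+ ey μ) (at j) * (x * (c * w (at j))))
                       (λ j → w (at j) * coeff P k (at j)) ⟩
  sumFrom a n (λ m → δ (+ ey μ) m * (x * (c * w m))) + sumFrom a n (λ m → w m * coeff P k m)
    ≡⟨ cong₂ _+_ (sumFrom-δ a {n} i (λ m → x * (c * w m)) {+ ey μ} eq)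
                 (sym (rowMoment-sumFrom a n P k w rest)) ⟩
  x * (c * w (+ ey μ)) + rowMoment P k w ∎)
  where
  x = δ (+ ex μ) k
  c = cf μ
  at = λ (j : Fin n) → a + + toℕ j
  expand : ∀ w x y c r → w * (x * (y * c) + r) ≡ y * (x * (c * w)) + w * r
  expand = solve-∀

-- Both moments are sums over m ∈ [-L, dn+L] with L = degY P: this range contains every
-- y-exponent of P and is symmetric about dn/2.
rowMoment-palindromic : ∀ d P → PalindromicRows d P → ∀ n →
  + 2 * rowMoment P (+ n) id ≡ + d * + n * rowSum P (+ n)
rowMoment-palindromic d P pal n = begin
  + 2 * rowMoment P k id
    ≡⟨ cong (+ 2 *_) (rowMoment-sumFrom a (suc N) P k id inRange) ⟩
  + 2 * sumFrom a (suc N) (λ m → m * coeff P k m)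
    ≡⟨ moment-palindromic a N (coeff P k) (subst (λ c → Palindromic c (coeff P k)) (sym centre) (pal k)) ⟩
  (a + a + + N) * sumFrom a (suc N) (coeff P k)
    ≡⟨ cong₂ _*_ centre (sum-cong-≗ {suc N} (λ i → sym (ℤP.*-identityˡ (coeff P k (a + + toℕ i))))) ⟩
  + d * k * sumFrom a (suc N) (λ m → 1ℤ * coeff P k m)
    ≡⟨ cong (+ d * k *_) (rowMoment-sumFrom a (suc N) P k (λ _ → 1ℤ) inRange) ⟨
  + d * k * rowSum P k ∎
  where
  k = + n
  L = degY P
  N = L ℕ.+ (d ℕ.* n ℕ.+ L)
  a = - + L
  centre : a + a + + N ≡ + d * k
  centre = begin
    a + a + + N
      ≡⟨ cong (λ z → a + a + z) (trans (ℤP.pos-+ L _) (cong (λ z → + L + z) (trans (ℤP.pos-+ (d ℕ.* n) L)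
                                                                     (cong (_+ + L) (ℤP.pos-* d n))))) ⟩
    a + a + (+ L + (+ d * k + + L))
      ≡⟨ cancel (+ L) (+ d * k) ⟩
    + d * k ∎
    where
    cancel : ∀ L K → - L + - L + (L + (K + L)) ≡ K
    cancel = solve-∀
  inRange : All (λ μ → Σ[ i ∈ Fin (suc N) ] a + + toℕ i ≡ + ey μ) P
  inRange = All.map position (degY-bound P)
    where
    position : ∀ {e} → e ≤ L → Σ[ i ∈ Fin (suc N) ] a + + toℕ i ≡ + e
    position {e} e≤L = fromℕ< (s≤s (ℕP.+-monoʳ-≤ L (ℕP.≤-trans e≤L (ℕP.m≤n+m L (d ℕ.* n)))))
                     , (begin
      a + + toℕ (fromℕ< _)   ≡⟨ cong (λ j → a + + j) (FinP.toℕ-fromℕ< _) ⟩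
      a + + (L ℕ.+ e)        ≡⟨ cong (λ z → a + z) (ℤP.pos-+ L e) ⟩
      a + (+ L + + e)        ≡⟨ cancel (+ L) (+ e) ⟩
      + e                    ∎)
      where
      cancel : ∀ L e → - L + (L + e) ≡ e
      cancel = solve-∀

if-≡ᵇ : ∀ a n (x acc : ℤ) → (if a ≡ᵇ n then x + acc else acc) ≡ δ (+ a) (+ n) * x + acc
if-≡ᵇ zero    zero    x acc = cong (_+ acc) (trans (sym (ℤP.*-identityˡ x)) (cong (_* x) (sym (δ-refl (+ 0)))))
if-≡ᵇ zero    (suc n) x acc = sym (trans (cong (λ z → z * x + acc) (δ-≢ λ ())) (ℤP.+-identityˡ acc))
if-≡ᵇ (suc a) zero    x acc = sym (trans (cong (λ z → z * x + acc) (δ-≢ λ ())) (ℤP.+-identityˡ acc))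
if-≡ᵇ (suc a) (suc n) x acc =
  trans (if-≡ᵇ a n x acc)
        (cong (λ z → z * x + acc)
              (δ-cong-⇔ (cong (λ z → 1ℤ + z)) (cong +_ ∘ ℕP.suc-injective ∘ ℤP.+-injective)))

coeff1-mulMono1-dyAtY1 : ∀ c P n → coeff1 (mulMono1 c 0 (dyAtY1 P)) n ≡ c * rowMoment P (+ n) id
coeff1-mulMono1-dyAtY1 c []      n = sym (ℤP.*-zeroʳ c)
coeff1-mulMono1-dyAtY1 c (μ ∷ P) n =
  trans (if-≡ᵇ (ex μ) n _ _)
        (trans (cong (λ z → δ (+ ex μ) (+ n) * (c * (cf μ * + ey μ)) + z) (coeff1-mulMono1-dyAtY1 c P n))
               (factor (δ (+ ex μ) (+ n)) c (cf μ * + ey μ) (rowMoment P (+ n) id)))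
  where
  factor : ∀ x c y r → x * (c * y) + c * r ≡ c * (x * y + r)
  factor = solve-∀

-- x·∂x sends c·x^a to a·c·x^(1 + (a ∸ 1)); for a = 0 the exponent is junk, but the coefficient is 0.
x∂x-term : ∀ a n (c f acc : ℤ) →
  (if suc (a ∸ 1) ≡ᵇ n then c * (f * + a) + acc else acc) ≡ δ (+ a) (+ n) * (c * (f * + a)) + acc
x∂x-term zero    n c f acc =
  trans (if-≡ᵇ 1 n (c * (f * 0ℤ)) acc) (vanish (δ (+ 1) (+ n)) (δ (+ 0) (+ n)) c f acc)
  where
  vanish : ∀ u v c f acc → u * (c * (f * 0ℤ)) + acc ≡ v * (c * (f * 0ℤ)) + acc
  vanish = solve-∀
x∂x-term (suc a) n c f acc = if-≡ᵇ (suc a) n (c * (f * + suc a)) acc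

coeff1-mulMono1-dxAtY1 : ∀ c P n → coeff1 (mulMono1 c 1 (dxAtY1 P)) n ≡ c * + n * rowSum P (+ n)
coeff1-mulMono1-dxAtY1 c []      n = sym (ℤP.*-zeroʳ (c * + n))
coeff1-mulMono1-dxAtY1 c (μ ∷ P) n = begin
  coeff1 (mulMono1 c 1 (dxAtY1 (μ ∷ P))) n
    ≡⟨ x∂x-term (ex μ) n c (cf μ) (coeff1 (mulMono1 c 1 (dxAtY1 P)) n) ⟩
  x * (c * (cf μ * + ex μ)) + coeff1 (mulMono1 c 1 (dxAtY1 P)) n
    ≡⟨ cong₂ _+_ (δ-*-cong _ _ (cong (λ z → c * (cf μ * z)))) (coeff1-mulMono1-dxAtY1 c P n) ⟩
  x * (c * (cf μ * + n)) + c * + n * rowSum P (+ n)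
    ≡⟨ factor x c (cf μ) (+ n) (rowSum P (+ n)) ⟩
  c * + n * (x * (cf μ * 1ℤ) + rowSum P (+ n)) ∎
  where
  x = δ (+ ex μ) (+ n)
  factor : ∀ x c f n r → x * (c * (f * n)) + c * n * r ≡ c * n * (x * (f * 1ℤ) + r)
  factor = solve-∀

lemma3p4 : (d : ℕ) → 1 ≤ d → (n : ℕ) →
    coeff1 (mulMono1 (+ 2) 0 (dyAtY1 (F d))) n ≡ coeff1 (mulMono1 (+ d) 1 (dxAtY1 (F d))) n
lemma3p4 zero    () n
lemma3p4 (suc d) _  n = begin
  coeff1 (mulMono1 (+ 2) 0 (dyAtY1 (F (suc d)))) n
    ≡⟨ coeff1-mulMono1-dyAtY1 (+ 2) (F (suc d)) n ⟩
  + 2 * rowMoment (F (suc d)) (+ n) id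
    ≡⟨ rowMoment-palindromic (suc d) (F (suc d)) (PalindromicRows-F d) n ⟩
  + suc d * + n * rowSum (F (suc d)) (+ n)
    ≡⟨ coeff1-mulMono1-dxAtY1 (+ suc d) (F (suc d)) n ⟨
  coeff1 (mulMono1 (+ suc d) 1 (dxAtY1 (F (suc d)))) n ∎
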